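{- Let $\delta$ be a positive integer, $k$ an even positive integer, and $G$ a graph of even order $n \geq 4$ with minimum degree $\delta(G) \geq \delta$. (i) If $n > 6\delta+2$ and $e(G) \geq e(K_\delta \vee (K_{n-2\delta} + \overline{K_\delta}))$, then $G$ is $\mathrm{GBC}_k$ unless $G = K_\delta \vee (K_{n-2\delta} + \overline{K_\delta})$. (ii) If $n = 6\delta+2$ and $e(G) \geq e(K_\delta \vee (K_{n-2\delta} + \overline{K_\delta}))$, then $G$ is $\mathrm{GBC}_k$ unless $G = K_\delta \vee (K_{n-2\delta} + \overline{K_\delta})$ or $G = K_{n/2} \vee \overline{K_{n/2}}$. (iii) If $n < 6\delta+2$ and $e(G) \geq e(K_{n/2} \vee \overline{K_{n/2}})$, then $G$ is $\mathrm{GBC}_k$ unless $G = K_{n/2} \vee \overline{K_{n/2}}$.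
   Context: All graphs are finite, simple, undirected and connected; $G = H$ means isomorphism. $e(G)$ is the number of edges, $\delta(G)$ the minimum degree. $K_m$ is the complete graph, $\overline{K_m}$ the edgeless graph on $m$ vertices, $+$ disjoint union, $\vee$ join. For $S \subseteq V(G)$, $G-S$ is obtained by deleting $S$; $i(G-S)$ is the number of isolated vertices of $G-S$ and $\mathrm{odd}(G-S)$ the number of nontrivial (at least 2 vertices) components of $G-S$ of odd order. Define, over all $S \subseteq V(G)$, the quantity $\phi_k(S) = k\cdot i(G-S) - k|S|$ if $k$ is even and $\phi_k(S) = \mathrm{odd}(G-S) + k\cdot i(G-S) - k|S|$ if $k$ is odd; $\mathrm{def}_k(G) = \max_{S \subseteq V(G)} \phi_k(S)$, and a set $S$ attaining this maximum is a $k$-barrier. A graph of even order is generalized bicritical ($\mathrm{GBC}_k$) if $\varnothing$ is its only $k$-barrier. -}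

module Defs where

open import Data.Nat using (ℕ; zero; suc; _+_; _*_; _≤_; _<ᵇ_; _≡ᵇ_; _%_)
open import Data.Nat.DivMod using (_/_)
open import Data.Integer using (ℤ; +_; _-_) renaming (_+_ to _+ℤ_; _≤_ to _≤ℤ_; _<_ to _<ℤ_)
open import Data.Bool using (Bool; true; false; _∧_; _∨_; not; if_then_else_)
open import Data.Bool.Properties using (∨-comm; ∧-comm)
open import Data.Fin using (Fin; toℕ; _≟_)
open import Data.Fin.Subset using (Subset; ∣_∣; ⁅_⁆; ⊥)
open import Data.Vec using (Vec; lookup; tabulate)
open import Data.List using (List; map; allFin)
open import Data.Nat.ListAction using (sum)
open import Data.Product using (Σ; _×_)
open import Function.Bundles using (_↔_; Inverse)
open import Relation.Nullary using (¬_; yes; no)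
open import Relation.Nullary.Decidable using (⌊_⌋)
open import Relation.Binary.PropositionalEquality using (_≡_; refl; sym; cong; cong₂)

record Graph (n : ℕ) : Set where
  field
    adj    : Fin n → Fin n → Bool
    adj-sym : ∀ i j → adj i j ≡ adj j i
    adj-irr : ∀ i → adj i i ≡ false
open Graph public

module _ {n : ℕ} (G : Graph n) where

  deg : Fin n → ℕ
  deg v = ∣ tabulate (adj G v) ∣

  MinDegreeAtLeast : ℕ → Set
  MinDegreeAtLeast d = ∀ v → d ≤ deg v

  edges : ℕ
  edges = sum (map (λ i → ∣ tabulate (λ j → adj G i j ∧ (toℕ i <ᵇ toℕ j)) ∣) (allFin n))

  step : Subset n → Subset n → Subset n
  step A R = tabulate λ j → lookup R j ∨
    (lookup A j ∧ not (∣ tabulate (λ i → lookup R i ∧ adj G i j) ∣ ≡ᵇ 0))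

  iter : ℕ → (Subset n → Subset n) → Subset n → Subset n
  iter zero    f R = R
  iter (suc m) f R = f (iter m f R)

  -- the vertex set of the component of v in the subgraph induced by A
  -- (for v ∈ A): closure under n steps (a shortest path has < n edges)
  component : Subset n → Fin n → Subset n
  component A v = iter n (step A) ⁅ v ⁆

  Connected : Set
  Connected = ∀ u v → lookup (component (tabulate (λ _ → true)) u) v ≡ true

  rest : Subset n → Subset n
  rest S = tabulate λ v → not (lookup S v)

  isolated : Subset n → ℕ
  isolated S = ∣ tabulate (λ v → not (lookup S v) ∧
                 (∣ tabulate (λ u → not (lookup S u) ∧ adj G v u) ∣ ≡ᵇ 0)) ∣

  -- odd(G - S): number of components of G - S with odd order ≥ 2
  -- (counted via their least vertex)
  oddComps : Subset n → ℕ
  oddComps S = ∣ tabulate (λ v → not (lookup S v) ∧ isLeast v ∧ oddNontrivial v) ∣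
    where
      C : Fin n → Subset n
      C v = component (rest S) v
      isLeast : Fin n → Bool
      isLeast v = ∣ tabulate (λ u → lookup (C v) u ∧ (toℕ u <ᵇ toℕ v)) ∣ ≡ᵇ 0
      oddNontrivial : Fin n → Bool
      oddNontrivial v = (1 <ᵇ ∣ C v ∣) ∧ (∣ C v ∣ % 2 ≡ᵇ 1)

  φ : ℕ → Subset n → ℤ
  φ k S = (+ (if k % 2 ≡ᵇ 0 then 0 else oddComps S))
            +ℤ (+ (k * isolated S)) - (+ (k * ∣ S ∣))

  Barrier : ℕ → Subset n → Set
  Barrier k S = ∀ T → φ k T ≤ℤ φ k S

  GBC : ℕ → Set
  GBC k = (n % 2 ≡ 0) × Barrier k ⊥ × (∀ S → Barrier k S → S ≡ ⊥)

_≅_ : {n : ℕ} → Graph n → Graph n → Set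
_≅_ {n} G H = Σ (Fin n ↔ Fin n) λ f →
  ∀ i j → adj G (Inverse.to f i) (Inverse.to f j) ≡ adj H i j

private
  neq : {n : ℕ} → Fin n → Fin n → Bool
  neq i j = not ⌊ i ≟ j ⌋

  neq-sym : {n : ℕ} (i j : Fin n) → neq i j ≡ neq j i
  neq-sym i j with i ≟ j | j ≟ i
  ... | yes _ | yes _ = refl
  ... | no _  | no _  = refl
  ... | yes p | no q  = Data.Empty.⊥-elim (q (sym p))
    where import Data.Empty
  ... | no p  | yes q = Data.Empty.⊥-elim (p (sym q))
    where import Data.Empty

  neq-irr : {n : ℕ} (i : Fin n) → neq i i ≡ false
  neq-irr i with i ≟ i
  ... | yes _ = refl
  ... | no p  = Data.Empty.⊥-elim (p refl)
    where import Data.Empty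

  mk : {n : ℕ} → (Fin n → Bool) → (Fin n → Bool) → Graph n
  mk a b = record
    { adj = λ i j → neq i j ∧ (a i ∨ a j ∨ (b i ∧ b j))
    ; adj-sym = λ i j → cong₂ _∧_ (neq-sym i j) (lem i j)
    ; adj-irr = λ i → cong (_∧ _) (neq-irr i)
    }
    where
      lem : ∀ i j → (a i ∨ a j ∨ (b i ∧ b j)) ≡ (a j ∨ a i ∨ (b j ∧ b i))
      lem i j rewrite ∧-comm (b i) (b j) with a i | a j
      ... | true  | true  = refl
      ... | true  | false = refl
      ... | false | true  = refl
      ... | false | false = refl

-- K_d ∨ (K_{n-2d} + \overline{K_d}) on Fin n:
-- vertices 0..d-1 form K_d, vertices d..n-d-1 form K_{n-2d},
-- vertices n-d..n-1 form the independent set \overline{K_d}.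
-- (Intended for 2d ≤ n.)
KdJoin : (n d : ℕ) → Graph n
KdJoin n d = mk (λ i → toℕ i <ᵇ d) (λ i → toℕ i <ᵇ (n Data.Nat.∸ d))
  where import Data.Nat

-- K_{n/2} ∨ \overline{K_{n/2}} on Fin n: vertices 0..n/2-1 form the clique,
-- the rest the independent set.
KhalfJoin : (n : ℕ) → Graph n
KhalfJoin n = mk (λ i → toℕ i <ᵇ (n / 2)) (λ _ → false)

-- For even k the odd-component term of φ_k vanishes, so φ_k(S) = k (i(G - S) - |S|) and G is
-- GBC_k unless some S has i(G - S) ≥ max(1, |S|).  For such an S put s = |S| and i = i(G - S):
-- every neighbour of an isolated vertex of G - S lies in S, so δ ≤ s ≤ i, and G is a spanning
-- subgraph of K_s ∨ (K_q + \overline{K_i}) with q = n - s - i.  Hence e(G) ≤ joinEdges s q i, with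
-- equality only if G is that join, and joins with equal part sizes are isomorphic.  Moving the
-- i - s surplus independent vertices into the clique, and then trading clique vertices for
-- hub/independent pairs, shows that for δ ≤ s ≤ i the count joinEdges s q i is maximal exactly at
-- (δ, n - 2δ, δ) if n > 6δ + 2, at (n/2, 0, n/2) if n < 6δ + 2, and at both if n = 6δ + 2; so the
-- edge hypothesis forces G to be one of the excluded graphs.

module Submission where

open import Axiom.UniquenessOfIdentityProofs using (module Decidable⇒UIP)
open import Data.Bool using (Bool; true; false; _∧_; _∨_; not; if_then_else_)
open import Data.Bool.Properties using (∧-zeroʳ; ∧-identityʳ; ∨-identityʳ; not-involutive)
open import Data.Empty using (⊥-elim)
open import Data.Fin using (Fin; zero; suc; toℕ; _≟_)
import Data.Fin.Properties as Fin
open import Data.Fin.Subset using (Subset; ∣_∣; ⊥)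
open import Data.Fin.Subset.Properties using (∣⊥∣≡0)
open import Data.Integer using (_⊖_) renaming (_≤_ to _≤ℤ_)
import Data.Integer as ℤ
open import Data.Integer.Properties using ([+m]-[+n]≡m⊖n; ⊖-monoˡ-≤; ⊖-monoˡ-<; n⊖n≡0)
import Data.Integer.Properties as ℤₚ
open import Data.List using (allFin)
import Data.List as List
open import Data.List.Properties using (map-tabulate)
open import Data.Nat using (ℕ; zero; suc; _+_; _*_; _∸_; _%_; _≤_; _<_; _<ᵇ_; _≡ᵇ_; z≤n; s≤s)
open import Data.Nat.DivMod using (_/_; m*n/n≡m; m/n≤m)
open import Data.Nat.Divisibility using (_∣_; n∣m⇒m%n≡0)
open import Data.Nat.ListAction using (sum)
open import Data.Nat.Properties hiding (_≟_)
open import Data.Nat.Tactic.RingSolver using (solve-∀)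
open import Data.Product using (Σ; ∃; _×_; _,_; proj₁; proj₂)
open import Data.Sum using (_⊎_; inj₁; inj₂; [_,_])
open import Data.Sum.Function.Propositional using (_⊎-↔_)
open import Data.Vec using ([]; _∷_; tabulate; lookup)
open import Data.Vec.Properties using (tabulate∘lookup)
open import Function using (_∘_; const)
open import Function.Bundles using (_↔_; Inverse; mk↔ₛ′)
open import Function.Properties.Inverse using (↔-refl; ↔-sym; ↔-trans)
open import Relation.Binary.Definitions using (DecidableEquality; tri<; tri≈; tri>)
open import Relation.Binary.PropositionalEquality hiding ([_])
open import Relation.Nullary using (¬_; yes; no; contradiction)
open import Relation.Nullary.Decidable using (⌊_⌋; isYes≗does)

open import Defs

variable
  n s q i : ℕ

iverson : Bool → ℕ
iverson true  = 1
iverson false = 0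

∑ : (Fin n → ℕ) → ℕ
∑ {zero}  f = 0
∑ {suc n} f = f zero + ∑ (f ∘ suc)

count : (Fin n → Bool) → ℕ
count f = ∑ (iverson ∘ f)

_⇒ᵇ_ : (Fin n → Bool) → (Fin n → Bool) → Set
f ⇒ᵇ g = ∀ j → f j ≡ true → g j ≡ true

∑-cong : {f g : Fin n → ℕ} → (∀ j → f j ≡ g j) → ∑ f ≡ ∑ g
∑-cong {zero}  _   = refl
∑-cong {suc n} f≗g = cong₂ _+_ (f≗g zero) (∑-cong (f≗g ∘ suc))

∑-mono : {f g : Fin n → ℕ} → (∀ j → f j ≤ g j) → ∑ f ≤ ∑ g
∑-mono {zero}  _   = z≤n
∑-mono {suc n} f≤g = +-mono-≤ (f≤g zero) (∑-mono (f≤g ∘ suc))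

+-mono-≤-tight : {a b c d : ℕ} → a ≤ b → c ≤ d → a + c ≡ b + d → a ≡ b × c ≡ d
+-mono-≤-tight {a} {b} {c} {d} a≤b c≤d a+c≡b+d =
  a≡b , +-cancelˡ-≡ a c d (trans a+c≡b+d (cong (_+ d) (sym a≡b)))
  where
  a≡b : a ≡ b
  a≡b = ≤-antisym a≤b (+-cancelʳ-≤ c b a (≤-trans (+-monoʳ-≤ b c≤d) (≤-reflexive (sym a+c≡b+d))))

∑-mono-tight : {f g : Fin n → ℕ} → (∀ j → f j ≤ g j) → ∑ f ≡ ∑ g → ∀ j → f j ≡ g j
∑-mono-tight {suc n} f≤g ∑f≡∑g j with +-mono-≤-tight (f≤g zero) (∑-mono (f≤g ∘ suc)) ∑f≡∑g
∑-mono-tight {suc n} f≤g ∑f≡∑g zero    | head≡ , _     = head≡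
∑-mono-tight {suc n} f≤g ∑f≡∑g (suc j) | _     , tail≡ = ∑-mono-tight (f≤g ∘ suc) tail≡ j

sum-allFin : (f : Fin n → ℕ) → sum (List.map f (allFin n)) ≡ ∑ f
sum-allFin f = trans (cong sum (map-tabulate (λ j → j) f)) (sum-tabulate f)
  where
  sum-tabulate : {m : ℕ} (g : Fin m → ℕ) → sum (List.tabulate g) ≡ ∑ g
  sum-tabulate {zero}  g = refl
  sum-tabulate {suc m} g = cong (g zero +_) (sum-tabulate (g ∘ suc))

iverson-mono : {x y : Bool} → (x ≡ true → y ≡ true) → iverson x ≤ iverson y
iverson-mono {false} _ = z≤n
iverson-mono {true}  x⇒y rewrite x⇒y refl = ≤-refl

iverson-injective : {x y : Bool} → iverson x ≡ iverson y → x ≡ y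
iverson-injective {false} {false} _ = refl
iverson-injective {true}  {true}  _ = refl

count-cong : {f g : Fin n → Bool} → (∀ j → f j ≡ g j) → count f ≡ count g
count-cong f≗g = ∑-cong (cong iverson ∘ f≗g)

count-mono : {f g : Fin n → Bool} → f ⇒ᵇ g → count f ≤ count g
count-mono f⇒g = ∑-mono (iverson-mono ∘ f⇒g)

count-mono-tight : {f g : Fin n → Bool} → f ⇒ᵇ g → count f ≡ count g → ∀ j → f j ≡ g j
count-mono-tight f⇒g eq = iverson-injective ∘ ∑-mono-tight (iverson-mono ∘ f⇒g) eq

count≡0⇒false : (f : Fin n → Bool) → count f ≡ 0 → ∀ j → f j ≡ false
count≡0⇒false {suc n} f _  zero    with f zero
... | false = refl
count≡0⇒false {suc n} f eq (suc j) with f zero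
... | false = count≡0⇒false (f ∘ suc) eq j

count>0⇒∃true : (f : Fin n → Bool) → 1 ≤ count f → ∃ λ j → f j ≡ true
count>0⇒∃true {suc n} f pos with f zero in eq
... | true  = zero , eq
... | false = let j , fj = count>0⇒∃true (f ∘ suc) pos in suc j , fj

∣tabulate∣≡count : (f : Fin n → Bool) → ∣ tabulate f ∣ ≡ count f
∣tabulate∣≡count {zero}  f = refl
∣tabulate∣≡count {suc n} f with f zero
... | true  = cong suc (∣tabulate∣≡count (f ∘ suc))
... | false = ∣tabulate∣≡count (f ∘ suc)

∣∣≡count : (S : Subset n) → ∣ S ∣ ≡ count (lookup S)
∣∣≡count S = trans (cong ∣_∣ (sym (tabulate∘lookup S))) (∣tabulate∣≡count (lookup S))

count-complement : (f : Fin n → Bool) → count f + count (not ∘ f) ≡ n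
count-complement {zero}  f = refl
count-complement {suc n} f with f zero
... | true  = cong suc (count-complement (f ∘ suc))
... | false = trans (+-suc _ _) (cong suc (count-complement (f ∘ suc)))

count-below : (d : ℕ) → d ≤ n → count {n} (λ j → toℕ j <ᵇ d) ≡ d
count-below {n} zero _ = count-none {n}
  where
  count-none : {m : ℕ} → count {m} (λ j → toℕ j <ᵇ 0) ≡ 0
  count-none {zero}  = refl
  count-none {suc m} = count-none {m}
count-below (suc d) (s≤s d≤n) = cong suc (count-below d d≤n)

-- Joins K_s ∨ (K_q + \overline{K_i}) and their edge counts

data Part : Set where
  hub clique indep : Part

_≟ₚ_ : DecidableEquality Part
hub    ≟ₚ hub    = yes refl
hub    ≟ₚ clique = no λ ()
hub    ≟ₚ indep  = no λ ()
clique ≟ₚ hub    = no λ ()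
clique ≟ₚ clique = yes refl
clique ≟ₚ indep  = no λ ()
indep  ≟ₚ hub    = no λ ()
indep  ≟ₚ clique = no λ ()
indep  ≟ₚ indep  = yes refl

linked : Part → Part → Bool
linked hub    _      = true
linked clique hub    = true
linked clique clique = true
linked clique indep  = false
linked indep  hub    = true
linked indep  _      = false

linked-sym : (x y : Part) → linked x y ≡ linked y x
linked-sym hub    hub    = refl
linked-sym hub    clique = refl
linked-sym hub    indep  = refl
linked-sym clique hub    = refl
linked-sym clique clique = refl
linked-sym clique indep  = refl
linked-sym indep  hub    = refl
linked-sym indep  clique = refl
linked-sym indep  indep  = refl

∑ₚ : (Part → ℕ) → ℕ
∑ₚ f = f hub + f clique + f indep

∑ₚ-cong : {f h : Part → ℕ} → (∀ p → f p ≡ h p) → ∑ₚ f ≡ ∑ₚ h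
∑ₚ-cong f≗h = cong₂ _+_ (cong₂ _+_ (f≗h hub) (f≗h clique)) (f≗h indep)

∑ₚ-+ : (f h : Part → ℕ) → ∑ₚ f + ∑ₚ h ≡ ∑ₚ (λ p → f p + h p)
∑ₚ-+ f h = lemma (f hub) (f clique) (f indep) (h hub) (h clique) (h indep)
  where
  lemma : ∀ a b c x y z → a + b + c + (x + y + z) ≡ a + x + (b + y) + (c + z)
  lemma = solve-∀

∑ₚ-pick : (f : Part → ℕ) (x : Part) → ∑ₚ (λ p → f p * iverson ⌊ x ≟ₚ p ⌋) ≡ f x
∑ₚ-pick f hub    = lemma (f hub) (f clique) (f indep)
  where
  lemma : ∀ a b c → a * 1 + b * 0 + c * 0 ≡ a
  lemma = solve-∀
∑ₚ-pick f clique = lemma (f hub) (f clique) (f indep)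
  where
  lemma : ∀ a b c → a * 0 + b * 1 + c * 0 ≡ b
  lemma = solve-∀
∑ₚ-pick f indep  = lemma (f hub) (f clique) (f indep)
  where
  lemma : ∀ a b c → a * 0 + b * 0 + c * 1 ≡ c
  lemma = solve-∀

size : (Fin n → Part) → Part → ℕ
size c p = count (λ v → ⌊ c v ≟ₚ p ⌋)

count-by-part : (g : Part → Bool) (c : Fin n → Part) →
  count (g ∘ c) ≡ ∑ₚ (λ p → iverson (g p) * size c p)
count-by-part {zero}  g c = sym (∑ₚ-cong (λ p → *-zeroʳ (iverson (g p))))
count-by-part {suc n} g c = begin
  iverson (g (c zero)) + count (g ∘ c ∘ suc)
    ≡⟨ cong₂ _+_ (sym (∑ₚ-pick (iverson ∘ g) (c zero))) (count-by-part g (c ∘ suc)) ⟩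
  ∑ₚ (λ p → iverson (g p) * iverson ⌊ c zero ≟ₚ p ⌋) + ∑ₚ (λ p → iverson (g p) * size (c ∘ suc) p)
    ≡⟨ ∑ₚ-+ (λ p → iverson (g p) * iverson ⌊ c zero ≟ₚ p ⌋) (λ p → iverson (g p) * size (c ∘ suc) p) ⟩
  ∑ₚ (λ p → iverson (g p) * iverson ⌊ c zero ≟ₚ p ⌋ + iverson (g p) * size (c ∘ suc) p)
    ≡⟨ ∑ₚ-cong (λ p → sym (*-distribˡ-+ (iverson (g p)) (iverson ⌊ c zero ≟ₚ p ⌋) (size (c ∘ suc) p))) ⟩
  ∑ₚ (λ p → iverson (g p) * size c p) ∎
  where open ≡-Reasoning

∑ₚ-size : (c : Fin n → Part) → ∑ₚ (size c) ≡ n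
∑ₚ-size {n} c = begin
  ∑ₚ (size c)                          ≡⟨ ∑ₚ-cong (λ p → sym (*-identityˡ (size c p))) ⟩
  ∑ₚ (λ p → 1 * size c p)              ≡⟨ sym (count-by-part (const true) c) ⟩
  count {n} (const true)               ≡⟨ count-all n ⟩
  n                                    ∎
  where
  open ≡-Reasoning
  count-all : (m : ℕ) → count {m} (const true) ≡ m
  count-all zero    = refl
  count-all (suc m) = cong suc (count-all m)

Adjacency : ℕ → Set
Adjacency n = Fin n → Fin n → Bool

pairCount : Adjacency n → ℕ
pairCount A = ∑ λ i → count λ j → A i j ∧ (toℕ i <ᵇ toℕ j)

edges≡pairCount : (G : Graph n) → edges G ≡ pairCount (adj G)
edges≡pairCount G =
  trans (sum-allFin (λ i → ∣ tabulate (row i) ∣)) (∑-cong λ i → ∣tabulate∣≡count (row i))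
  where
  row : Fin _ → Fin _ → Bool
  row i j = adj G i j ∧ (toℕ i <ᵇ toℕ j)

pairCount-cong : {A B : Adjacency n} → (∀ i j → A i j ≡ B i j) → pairCount A ≡ pairCount B
pairCount-cong A≗B = ∑-cong λ i → count-cong λ j → cong (_∧ _) (A≗B i j)

pairCount-suc : (A : Adjacency (suc n)) →
  pairCount A ≡ count (λ j → A zero (suc j)) + pairCount (λ i j → A (suc i) (suc j))
pairCount-suc A = cong₂ _+_
  (cong₂ _+_ (cong iverson (∧-zeroʳ (A zero zero))) (count-cong λ j → ∧-identityʳ (A zero (suc j))))
  (∑-cong λ i → cong (_+ count (λ j → A (suc i) (suc j) ∧ (toℕ i <ᵇ toℕ j)))
                      (cong iverson (∧-zeroʳ (A (suc i) zero))))

distinct : Fin n → Fin n → Bool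
distinct i j = not ⌊ i ≟ j ⌋

-- Not definitional: ⌊_⌋ does not compute through the map′ in the successor case of _≟_.
distinct-suc : (i j : Fin n) → distinct (suc i) (suc j) ≡ distinct i j
distinct-suc i j = cong not (trans (isYes≗does (suc i ≟ suc j)) (sym (isYes≗does (i ≟ j))))

distinct-refl : (u : Fin n) → distinct u u ≡ false
distinct-refl u with u ≟ u
... | yes _  = refl
... | no u≢u = ⊥-elim (u≢u refl)

distinct-sym : (u v : Fin n) → distinct u v ≡ distinct v u
distinct-sym u v with u ≟ v | v ≟ u
... | yes _   | yes _   = refl
... | no _    | no _    = refl
... | yes u≡v | no v≢u  = ⊥-elim (v≢u (sym u≡v))
... | no u≢v  | yes v≡u = ⊥-elim (u≢v (sym v≡u))

distinct-injective : (f g : Fin n → Fin n) → (∀ v → g (f v) ≡ v) →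
  ∀ u v → distinct (f u) (f v) ≡ distinct u v
distinct-injective f g g∘f u v with u ≟ v | f u ≟ f v
... | yes _   | yes _     = refl
... | no _    | no _      = refl
... | yes refl | no fu≢fu = ⊥-elim (fu≢fu refl)
... | no u≢v  | yes fu≡fv = ⊥-elim (u≢v (trans (sym (g∘f u)) (trans (cong g fu≡fv) (g∘f v))))

adj⇒distinct : (G : Graph n) {u v : Fin n} → adj G u v ≡ true → distinct u v ≡ true
adj⇒distinct G {u} {v} uv with u ≟ v
... | yes refl = contradiction (trans (sym (adj-irr G u)) uv) λ ()
... | no _     = refl

joinAdj : (Fin n → Part) → Adjacency n
joinAdj c u v = distinct u v ∧ linked (c u) (c v)

joinAdj-sym : (c : Fin n → Part) (u v : Fin n) → joinAdj c u v ≡ joinAdj c v u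
joinAdj-sym c u v = cong₂ _∧_ (distinct-sym u v) (linked-sym (c u) (c v))

pairs : ℕ → ℕ
pairs zero    = 0
pairs (suc m) = m + pairs m

joinEdges : ℕ → ℕ → ℕ → ℕ
joinEdges s q i = pairs s + s * (q + i) + pairs q

joinEdges-cong : {s q i s′ q′ i′ : ℕ} → s ≡ s′ → q ≡ q′ → i ≡ i′ →
  joinEdges s q i ≡ joinEdges s′ q′ i′
joinEdges-cong refl refl refl = refl

joinEdges-add : (x : Part) (f : Part → ℕ) →
  ∑ₚ (λ p → iverson (linked x p) * f p) + joinEdges (f hub) (f clique) (f indep)
  ≡ joinEdges (iverson ⌊ x ≟ₚ hub ⌋ + f hub) (iverson ⌊ x ≟ₚ clique ⌋ + f clique)
              (iverson ⌊ x ≟ₚ indep ⌋ + f indep)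
joinEdges-add hub    f = lemma (f hub) (f clique) (f indep) (pairs (f hub)) (pairs (f clique))
  where
  lemma : ∀ s q i ps pq → 1 * s + 1 * q + 1 * i + (ps + s * (q + i) + pq) ≡ (s + ps) + (1 + s) * (q + i) + pq
  lemma = solve-∀
joinEdges-add clique f = lemma (f hub) (f clique) (f indep) (pairs (f hub)) (pairs (f clique))
  where
  lemma : ∀ s q i ps pq → 1 * s + 1 * q + 0 * i + (ps + s * (q + i) + pq) ≡ ps + s * ((1 + q) + i) + (q + pq)
  lemma = solve-∀
joinEdges-add indep  f = lemma (f hub) (f clique) (f indep) (pairs (f hub)) (pairs (f clique))
  where
  lemma : ∀ s q i ps pq → 1 * s + 0 * q + 0 * i + (ps + s * (q + i) + pq) ≡ ps + s * (q + (1 + i)) + pq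
  lemma = solve-∀

pairCount-joinAdj : (c : Fin n → Part) →
  pairCount (joinAdj c) ≡ joinEdges (size c hub) (size c clique) (size c indep)
pairCount-joinAdj {zero}  c = refl
pairCount-joinAdj {suc n} c = begin
  pairCount (joinAdj c)
    ≡⟨ pairCount-suc (joinAdj c) ⟩
  count (linked (c zero) ∘ c ∘ suc) + pairCount (λ i j → joinAdj c (suc i) (suc j))
    ≡⟨ cong₂ _+_ (count-by-part (linked (c zero)) (c ∘ suc))
                 (trans (pairCount-cong λ i j → cong (_∧ linked (c (suc i)) (c (suc j))) (distinct-suc i j))
                        (pairCount-joinAdj (c ∘ suc))) ⟩
  ∑ₚ (λ p → iverson (linked (c zero) p) * size (c ∘ suc) p)
    + joinEdges (size (c ∘ suc) hub) (size (c ∘ suc) clique) (size (c ∘ suc) indep)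
    ≡⟨ joinEdges-add (c zero) (size (c ∘ suc)) ⟩
  joinEdges (size c hub) (size c clique) (size c indep) ∎
  where open ≡-Reasoning

record JoinPartition (n s q i : ℕ) : Set where
  field
    part    : Fin n → Part
    #hub    : size part hub ≡ s
    #clique : size part clique ≡ q
    #indep  : size part indep ≡ i

  total : s + q + i ≡ n
  total = trans (sym (cong₂ _+_ (cong₂ _+_ #hub #clique) #indep)) (∑ₚ-size part)

  pairCount-joinAdj-part : pairCount (joinAdj part) ≡ joinEdges s q i
  pairCount-joinAdj-part = trans (pairCount-joinAdj part) (joinEdges-cong #hub #clique #indep)

joinPartition : (c : Fin n → Part) → size c hub ≡ s → size c indep ≡ i → s + q + i ≡ n →
  JoinPartition n s q i
joinPartition {n} {s} {i} {q} c #hub #indep s+q+i≡n = record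
  { part = c ; #hub = #hub ; #clique = #clique ; #indep = #indep }
  where
  #clique : size c clique ≡ q
  #clique = +-cancelˡ-≡ s _ _ (+-cancelʳ-≡ i _ _ (begin
    s + size c clique + i                        ≡⟨ cong₂ (λ h d → h + size c clique + d) (sym #hub) (sym #indep) ⟩
    size c hub + size c clique + size c indep    ≡⟨ ∑ₚ-size c ⟩
    n                                            ≡⟨ sym s+q+i≡n ⟩
    s + q + i                                    ∎))
    where open ≡-Reasoning

_⊆ᵃ_ : Adjacency n → Adjacency n → Set
A ⊆ᵃ B = ∀ u v → A u v ≡ true → B u v ≡ true

record IsJoin (G : Graph n) (s q i : ℕ) : Set where
  constructor _,_
  field
    partition : JoinPartition n s q i
    adj≡      : ∀ u v → adj G u v ≡ joinAdj (JoinPartition.part partition) u v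
  open JoinPartition partition public using (total)

record IsSubJoin (G : Graph n) (s q i : ℕ) : Set where
  constructor _,_
  field
    partition : JoinPartition n s q i
    adj⊆      : adj G ⊆ᵃ joinAdj (JoinPartition.part partition)
  open JoinPartition partition public using (total)

∧-monoˡ : {x y : Bool} (z : Bool) → (x ≡ true → y ≡ true) → x ∧ z ≡ true → y ∧ z ≡ true
∧-monoˡ {true} z x⇒y x∧z rewrite x⇒y refl = x∧z

pairCount-mono : {A B : Adjacency n} → A ⊆ᵃ B → pairCount A ≤ pairCount B
pairCount-mono A⊆B = ∑-mono λ i → count-mono λ j → ∧-monoˡ _ (A⊆B i j)

pairCount-tight : {A B : Adjacency n} → A ⊆ᵃ B → pairCount A ≡ pairCount B →
  ∀ u v → toℕ u < toℕ v → A u v ≡ B u v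
pairCount-tight {A = A} {B} A⊆B eq u v u<v
  with toℕ u <ᵇ toℕ v | <⇒<ᵇ u<v
     | count-mono-tight (λ j → ∧-monoˡ _ (A⊆B u j))
                        (∑-mono-tight (λ i → count-mono λ j → ∧-monoˡ _ (A⊆B i j)) eq u) v
... | true | _ | A∧≡B∧ = trans (sym (∧-identityʳ (A u v))) (trans A∧≡B∧ (∧-identityʳ (B u v)))

subgraph-tight : (G : Graph n) (c : Fin n → Part) → adj G ⊆ᵃ joinAdj c →
  edges G ≡ pairCount (joinAdj c) → ∀ u v → adj G u v ≡ joinAdj c u v
subgraph-tight G c G⊆c eq u v with Fin.<-cmp u v
... | tri< u<v _ _ = pairCount-tight G⊆c (trans (sym (edges≡pairCount G)) eq) u v u<v
... | tri> _ _ v<u = trans (adj-sym G u v)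
                       (trans (pairCount-tight G⊆c (trans (sym (edges≡pairCount G)) eq) v u v<u) (joinAdj-sym c v u))
... | tri≈ _ refl _ = trans (adj-irr G u) (sym (cong (_∧ _) (distinct-refl u)))

isJoin-edges : (G : Graph n) → IsJoin G s q i → edges G ≡ joinEdges s q i
isJoin-edges G (P , G≗P) =
  trans (edges≡pairCount G) (trans (pairCount-cong G≗P) (JoinPartition.pairCount-joinAdj-part P))

isSubJoin-edges : (G : Graph n) → IsSubJoin G s q i → edges G ≤ joinEdges s q i
isSubJoin-edges {s = s} {q} {i} G (P , G⊆P) = begin
  edges G                                    ≡⟨ edges≡pairCount G ⟩
  pairCount (adj G)                          ≤⟨ pairCount-mono G⊆P ⟩
  pairCount (joinAdj (JoinPartition.part P)) ≡⟨ JoinPartition.pairCount-joinAdj-part P ⟩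
  joinEdges s q i                            ∎
  where open ≤-Reasoning

isSubJoin-tight : (G : Graph n) → IsSubJoin G s q i → joinEdges s q i ≤ edges G → IsJoin G s q i
isSubJoin-tight G (P , G⊆P) e≤edges = P , subgraph-tight G part G⊆P
  (trans (≤-antisym (isSubJoin-edges G (P , G⊆P)) e≤edges) (sym pairCount-joinAdj-part))
  where open JoinPartition P

-- Joins with equal part sizes are isomorphic

Fibre : {A : Set} → (Fin n → A) → A → Set
Fibre {n} c a = Σ (Fin n) λ v → c v ≡ a

fibre-suc : {A : Set} (c : Fin (suc n) → A) (a : A) → Fibre c a ↔ ((c zero ≡ a) ⊎ Fibre (c ∘ suc) a)
fibre-suc c a = mk↔ₛ′ to from to∘from from∘to
  where
  to : Fibre c a → (c zero ≡ a) ⊎ Fibre (c ∘ suc) a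
  to (zero  , e) = inj₁ e
  to (suc v , e) = inj₂ (v , e)
  from : (c zero ≡ a) ⊎ Fibre (c ∘ suc) a → Fibre c a
  from (inj₁ e)       = zero , e
  from (inj₂ (v , e)) = suc v , e
  to∘from : ∀ x → to (from x) ≡ x
  to∘from (inj₁ _) = refl
  to∘from (inj₂ _) = refl
  from∘to : ∀ x → from (to x) ≡ x
  from∘to (zero  , _) = refl
  from∘to (suc _ , _) = refl

≡↔Fin : {A : Set} (_≟ᴬ_ : DecidableEquality A) (x a : A) → (x ≡ a) ↔ Fin (iverson ⌊ x ≟ᴬ a ⌋)
≡↔Fin _≟ᴬ_ x a with x ≟ᴬ a
... | yes x≡a =
  mk↔ₛ′ (const zero) (const x≡a) (λ { zero → refl }) (Decidable⇒UIP.≡-irrelevant _≟ᴬ_ x≡a)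
... | no  x≢a = mk↔ₛ′ (⊥-elim ∘ x≢a) (λ ()) (λ ()) (⊥-elim ∘ x≢a)

fibre↔Fin : {A : Set} (_≟ᴬ_ : DecidableEquality A) (c : Fin n → A) (a : A) →
  Fibre c a ↔ Fin (count (λ v → ⌊ c v ≟ᴬ a ⌋))
fibre↔Fin {zero}  _≟ᴬ_ c a = mk↔ₛ′ (λ { (() , _) }) (λ ()) (λ ()) (λ { (() , _) })
fibre↔Fin {suc n} _≟ᴬ_ c a =
  ↔-trans (fibre-suc c a)
    (↔-trans (≡↔Fin _≟ᴬ_ (c zero) a ⊎-↔ fibre↔Fin _≟ᴬ_ (c ∘ suc) a) (↔-sym Fin.+↔⊎))

along : {A : Set} {c c′ : Fin n → A} → (∀ a → Fibre c a → Fibre c′ a) → Fin n → Fin n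
along {c = c} φ v = proj₁ (φ (c v) (v , refl))

along-part : {A : Set} {c c′ : Fin n → A} (φ : ∀ a → Fibre c a → Fibre c′ a) (v : Fin n) →
  c′ (along φ v) ≡ c v
along-part {c = c} φ v = proj₂ (φ (c v) (v , refl))

along-fibre : {A : Set} {c c′ : Fin n → A} (φ : ∀ a → Fibre c a → Fibre c′ a) (a : A) (x : Fibre c a) →
  along φ (proj₁ x) ≡ proj₁ (φ a x)
along-fibre φ a (v , refl) = refl

along-cancel : {A : Set} {c c′ : Fin n → A}
  (φ : ∀ a → Fibre c a → Fibre c′ a) (χ : ∀ a → Fibre c′ a → Fibre c a) →
  (∀ a x → χ a (φ a x) ≡ x) → ∀ v → along χ (along φ v) ≡ v
along-cancel {c = c} φ χ χ∘φ v =
  trans (along-fibre χ (c v) (φ (c v) (v , refl))) (cong proj₁ (χ∘φ (c v) (v , refl)))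

fibrewise-permutation : {A : Set} {c c′ : Fin n → A} → (∀ a → Fibre c a ↔ Fibre c′ a) →
  Σ (Fin n ↔ Fin n) λ σ → ∀ v → c′ (Inverse.to σ v) ≡ c v
fibrewise-permutation ψ =
  mk↔ₛ′ (along to) (along from) (along-cancel from to λ a → Inverse.strictlyInverseˡ (ψ a))
                                 (along-cancel to from λ a → Inverse.strictlyInverseʳ (ψ a)) ,
  along-part to
  where
  to   = λ a → Inverse.to (ψ a)
  from = λ a → Inverse.from (ψ a)

sizes-agree : (P Q : JoinPartition n s q i) → ∀ p →
  size (JoinPartition.part P) p ≡ size (JoinPartition.part Q) p
sizes-agree P Q hub    = trans (JoinPartition.#hub P) (sym (JoinPartition.#hub Q))
sizes-agree P Q clique = trans (JoinPartition.#clique P) (sym (JoinPartition.#clique Q))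
sizes-agree P Q indep  = trans (JoinPartition.#indep P) (sym (JoinPartition.#indep Q))

isJoin-≅ : (G K : Graph n) → IsJoin G s q i → IsJoin K s q i → G ≅ K
isJoin-≅ G K (P , G≗P) (Q , K≗Q) = σ , λ u v → begin
  adj G (to u) (to v)                                        ≡⟨ G≗P (to u) (to v) ⟩
  distinct (to u) (to v) ∧ linked (part P (to u)) (part P (to v))
    ≡⟨ cong₂ _∧_ (distinct-injective to from (Inverse.strictlyInverseʳ σ) u v)
                 (cong₂ linked (recoloured u) (recoloured v)) ⟩
  distinct u v ∧ linked (part Q u) (part Q v)                ≡⟨ sym (K≗Q u v) ⟩
  adj K u v                                                  ∎
  where
  open ≡-Reasoning
  open JoinPartition using (part)
  fibres : ∀ a → Fibre (part Q) a ↔ Fibre (part P) a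
  fibres a = ↔-trans (fibre↔Fin _≟ₚ_ (part Q) a)
               (↔-trans (subst (λ m → Fin (size (part Q) a) ↔ Fin m) (sizes-agree Q P a) ↔-refl)
                        (↔-sym (fibre↔Fin _≟ₚ_ (part P) a)))
  permutation = fibrewise-permutation fibres
  σ = proj₁ permutation
  recoloured = proj₂ permutation
  to = Inverse.to σ
  from = Inverse.from σ

stack : (Fin n → Bool) → (Fin n → Bool) → Fin n → Part
stack a b v = if a v then hub else if b v then clique else indep

linked-stack : (a b : Fin n → Bool) (u v : Fin n) →
  (a u ∨ a v ∨ (b u ∧ b v)) ≡ linked (stack a b u) (stack a b v)
linked-stack a b u v with a u | a v | b u | b v
... | true  | _     | _     | _     = refl
... | false | true  | true  | _     = refl
... | false | true  | false | _     = refl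
... | false | false | true  | true  = refl
... | false | false | true  | false = refl
... | false | false | false | true  = refl
... | false | false | false | false = refl

size-stack-hub : (a b : Fin n → Bool) → size (stack a b) hub ≡ count a
size-stack-hub a b = count-cong λ v → lemma (a v) (b v)
  where
  lemma : ∀ x y → ⌊ (if x then hub else if y then clique else indep) ≟ₚ hub ⌋ ≡ x
  lemma true  _     = refl
  lemma false true  = refl
  lemma false false = refl

size-stack-indep : (a b : Fin n → Bool) → size (stack a b) indep ≡ count (λ v → not (a v ∨ b v))
size-stack-indep a b = count-cong λ v → lemma (a v) (b v)
  where
  lemma : ∀ x y → ⌊ (if x then hub else if y then clique else indep) ≟ₚ indep ⌋ ≡ not (x ∨ y)
  lemma true  _     = refl
  lemma false true  = refl
  lemma false false = refl

<ᵇ-mono : (x : ℕ) {d e : ℕ} → d ≤ e → (x <ᵇ d) ≡ true → (x <ᵇ e) ≡ true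
<ᵇ-mono zero    {suc d} {suc e} _         _   = refl
<ᵇ-mono (suc x) {suc d} {suc e} (s≤s d≤e) x<d = <ᵇ-mono x d≤e x<d

a+b+a≡a+a+b : ∀ a b → a + b + a ≡ a + a + b
a+b+a≡a+a+b = solve-∀

KdJoin-isJoin : (n d : ℕ) → d + d ≤ n → IsJoin (KdJoin n d) d (n ∸ (d + d)) d
KdJoin-isJoin n d 2d≤n =
  joinPartition (stack low mid) #hub #indep total , λ u v → cong (distinct u v ∧_) (linked-stack low mid u v)
  where
  low mid : Fin n → Bool
  low v = toℕ v <ᵇ d
  mid v = toℕ v <ᵇ n ∸ d
  d≤n∸d : d ≤ n ∸ d
  d≤n∸d = m+n≤o⇒m≤o∸n d 2d≤n
  #hub : size (stack low mid) hub ≡ d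
  #hub = trans (size-stack-hub low mid) (count-below d (≤-trans d≤n∸d (m∸n≤m n d)))
  low⇒mid : ∀ v → not (low v ∨ mid v) ≡ not (mid v)
  low⇒mid v with low v in v<d
  ... | false = refl
  ... | true  rewrite <ᵇ-mono (toℕ v) d≤n∸d v<d = refl
  #indep : size (stack low mid) indep ≡ d
  #indep = begin
    size (stack low mid) indep    ≡⟨ size-stack-indep low mid ⟩
    count (λ v → not (low v ∨ mid v)) ≡⟨ count-cong low⇒mid ⟩
    count (not ∘ mid)             ≡⟨ +-cancelˡ-≡ (n ∸ d) _ _ (begin
      n ∸ d + count (not ∘ mid)      ≡⟨ cong (_+ count (not ∘ mid)) (sym (count-below (n ∸ d) (m∸n≤m n d))) ⟩
      count mid + count (not ∘ mid)  ≡⟨ count-complement mid ⟩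
      n                              ≡⟨ sym (m∸n+n≡m (≤-trans d≤n∸d (m∸n≤m n d))) ⟩
      n ∸ d + d                      ∎) ⟩
    d                             ∎
    where open ≡-Reasoning
  total : d + (n ∸ (d + d)) + d ≡ n
  total = trans (a+b+a≡a+a+b d (n ∸ (d + d))) (m+[n∸m]≡n 2d≤n)

KhalfJoin-isJoin : (n m : ℕ) → n ≡ m * 2 → IsJoin (KhalfJoin n) m 0 m
KhalfJoin-isJoin n m n≡2m =
  joinPartition (stack low none) #hub #indep total , λ u v → cong (distinct u v ∧_) (linked-stack low none u v)
  where
  low none : Fin n → Bool
  low v = toℕ v <ᵇ n / 2
  none _ = false
  n/2≡m : n / 2 ≡ m
  n/2≡m = trans (cong (_/ 2) n≡2m) (m*n/n≡m m 2)
  count-low : count low ≡ m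
  count-low = trans (count-below (n / 2) (m/n≤m n 2)) n/2≡m
  total : m + 0 + m ≡ n
  total = trans (lemma m) (sym n≡2m)
    where
    lemma : ∀ a → a + 0 + a ≡ a * 2
    lemma = solve-∀
  #hub : size (stack low none) hub ≡ m
  #hub = trans (size-stack-hub low none) count-low
  #indep : size (stack low none) indep ≡ m
  #indep = begin
    size (stack low none) indep        ≡⟨ size-stack-indep low none ⟩
    count (λ v → not (low v ∨ false))  ≡⟨ count-cong (λ v → cong not (∨-identityʳ (low v))) ⟩
    count (not ∘ low)                  ≡⟨ +-cancelˡ-≡ m _ _ (begin
      m + count (not ∘ low)               ≡⟨ cong (_+ count (not ∘ low)) (sym count-low) ⟩
      count low + count (not ∘ low)       ≡⟨ count-complement low ⟩
      n                                   ≡⟨ sym total ⟩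
      m + 0 + m                           ≡⟨ cong (_+ m) (+-identityʳ m) ⟩
      m + m                               ∎) ⟩
    m                                  ∎
    where open ≡-Reasoning

-- Deleting a vertex set

isolatedIn : Graph n → Subset n → Fin n → Bool
isolatedIn G S v = not (lookup S v) ∧ (∣ tabulate (λ u → not (lookup S u) ∧ adj G v u) ∣ ≡ᵇ 0)

isolated≡count : (G : Graph n) (S : Subset n) → isolated G S ≡ count (isolatedIn G S)
isolated≡count G S = ∣tabulate∣≡count (isolatedIn G S)

isolated-neighbour : (G : Graph n) (S : Subset n) {u v : Fin n} →
  isolatedIn G S u ≡ true → adj G u v ≡ true → lookup S v ≡ true
isolated-neighbour G S {u} {v} u-isolated uv =
  outside-is-false (lookup S v) uv (count≡0⇒false outside-neighbour no-outside-neighbour v)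
  where
  outside-neighbour : Fin _ → Bool
  outside-neighbour w = not (lookup S w) ∧ adj G u w
  no-outside-neighbour : count outside-neighbour ≡ 0
  no-outside-neighbour = trans (sym (∣tabulate∣≡count outside-neighbour))
                               (≡ᵇ0 ∣ tabulate outside-neighbour ∣ (∧-trueʳ (not (lookup S u)) u-isolated))
    where
    ∧-trueʳ : ∀ x {y} → x ∧ y ≡ true → y ≡ true
    ∧-trueʳ true y≡true = y≡true
    ≡ᵇ0 : ∀ m → (m ≡ᵇ 0) ≡ true → m ≡ 0
    ≡ᵇ0 zero _ = refl
  outside-is-false : ∀ x {y} → y ≡ true → not x ∧ y ≡ false → x ≡ true
  outside-is-false true  _    _ = refl
  outside-is-false false refl ()

isolated-degree : (G : Graph n) (S : Subset n) {v : Fin n} → isolatedIn G S v ≡ true → deg G v ≤ ∣ S ∣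
isolated-degree G S {v} v-isolated = begin
  deg G v            ≡⟨ ∣tabulate∣≡count (adj G v) ⟩
  count (adj G v)    ≤⟨ count-mono (λ u → isolated-neighbour G S {v} {u} v-isolated) ⟩
  count (lookup S)   ≡⟨ sym (∣∣≡count S) ⟩
  ∣ S ∣              ∎
  where open ≤-Reasoning

minDegree≤∣S∣ : (G : Graph n) (S : Subset n) {δ : ℕ} → MinDegreeAtLeast G δ → 1 ≤ isolated G S →
  δ ≤ ∣ S ∣
minDegree≤∣S∣ G S δ≤deg some-isolated =
  let v , v-isolated = count>0⇒∃true (isolatedIn G S) (subst (1 ≤_) (isolated≡count G S) some-isolated)
  in ≤-trans (δ≤deg v) (isolated-degree G S v-isolated)

removalPart : Graph n → Subset n → Fin n → Part
removalPart G S = stack (lookup S) (not ∘ isolatedIn G S)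

removal-isSubJoin : (G : Graph n) (S : Subset n) →
  IsSubJoin G ∣ S ∣ (size (removalPart G S) clique) (isolated G S)
removal-isSubJoin G S = partition , covered
  where
  partition : JoinPartition _ ∣ S ∣ (size (removalPart G S) clique) (isolated G S)
  partition = record
    { part    = removalPart G S
    ; #hub    = trans (size-stack-hub (lookup S) _) (sym (∣∣≡count S))
    ; #clique = refl
    ; #indep  = trans (size-stack-indep (lookup S) _)
                      (trans (count-cong isolated-outside) (sym (isolated≡count G S)))
    }
    where
    isolated-outside : ∀ v → not (lookup S v ∨ not (isolatedIn G S v)) ≡ isolatedIn G S v
    isolated-outside v with lookup S v
    ... | true  = refl
    ... | false = not-involutive _
  covered : adj G ⊆ᵃ joinAdj (removalPart G S)
  covered u v uv =
    trans (cong₂ _∧_ (adj⇒distinct G uv) (sym (linked-stack (lookup S) (not ∘ isolatedIn G S) u v)))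
    (edge-covered (lookup S u) (lookup S v) (isolatedIn G S u) (isolatedIn G S v)
      (λ u-isolated → isolated-neighbour G S u-isolated uv)
      (λ v-isolated → isolated-neighbour G S v-isolated (trans (adj-sym G v u) uv)))
    where
    edge-covered : ∀ su sv iu iv → (iu ≡ true → sv ≡ true) → (iv ≡ true → su ≡ true) →
      su ∨ sv ∨ (not iu ∧ not iv) ≡ true
    edge-covered true  _     _     _     _  _  = refl
    edge-covered false true  _     _     _  _  = refl
    edge-covered false false false false _  _  = refl
    edge-covered false false true  _     u⇒ _  = contradiction (u⇒ refl) λ ()
    edge-covered false false false true  _  v⇒ = contradiction (v⇒ refl) λ ()

-- Barriers for even k

Isolating : Graph n → Subset n → Set
Isolating G S = 1 ≤ isolated G S × ∣ S ∣ ≤ isolated G S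

φ-even : (G : Graph n) (k : ℕ) (S : Subset n) → k % 2 ≡ 0 → φ G k S ≡ (k * isolated G S) ⊖ (k * ∣ S ∣)
φ-even G k S k-even = trans (drop-odd (k % 2) k-even) ([+m]-[+n]≡m⊖n (k * isolated G S) (k * ∣ S ∣))
  where
  drop-odd : ∀ r → r ≡ 0 →
    (ℤ.+ (if r ≡ᵇ 0 then 0 else oddComps G S)) ℤ.+ (ℤ.+ (k * isolated G S)) ℤ.- (ℤ.+ (k * ∣ S ∣))
    ≡ (ℤ.+ (k * isolated G S)) ℤ.- (ℤ.+ (k * ∣ S ∣))
  drop-odd .0 refl = refl

φ-even-≤0 : (G : Graph n) (k : ℕ) (T : Subset n) → k % 2 ≡ 0 → isolated G T ≤ ∣ T ∣ →
  φ G k T ≤ℤ ℤ.+ 0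
φ-even-≤0 G k T k-even i≤s = begin
  φ G k T                              ≡⟨ φ-even G k T k-even ⟩
  (k * isolated G T) ⊖ (k * ∣ T ∣)     ≤⟨ ⊖-monoˡ-≤ (k * ∣ T ∣) (*-monoʳ-≤ k i≤s) ⟩
  (k * ∣ T ∣) ⊖ (k * ∣ T ∣)            ≡⟨ n⊖n≡0 (k * ∣ T ∣) ⟩
  ℤ.+ 0                                ∎
  where open ℤₚ.≤-Reasoning

φ-even-≥0 : (G : Graph n) (k : ℕ) (T : Subset n) → 1 ≤ k → k % 2 ≡ 0 → ℤ.+ 0 ≤ℤ φ G k T →
  ∣ T ∣ ≤ isolated G T
φ-even-≥0 G k@(suc _) T _ k-even 0≤φ with ∣ T ∣ ≤? isolated G T
... | yes s≤i = s≤i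
... | no  s≰i = contradiction 0≤φ (ℤₚ.<⇒≱ (begin-strict
  φ G k T                              ≡⟨ φ-even G k T k-even ⟩
  (k * isolated G T) ⊖ (k * ∣ T ∣)     <⟨ ⊖-monoˡ-< (k * ∣ T ∣) (*-monoʳ-< k (≰⇒> s≰i)) ⟩
  (k * ∣ T ∣) ⊖ (k * ∣ T ∣)            ≡⟨ n⊖n≡0 (k * ∣ T ∣) ⟩
  ℤ.+ 0                                ∎))
  where open ℤₚ.≤-Reasoning

∣p∣≡0⇒p≡⊥ : (p : Subset n) → ∣ p ∣ ≡ 0 → p ≡ ⊥
∣p∣≡0⇒p≡⊥ []          _  = refl
∣p∣≡0⇒p≡⊥ (false ∷ p) eq = cong (false ∷_) (∣p∣≡0⇒p≡⊥ p eq)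

GBC-if-no-isolating-set : (G : Graph n) {k : ℕ} → 1 ≤ k → 2 ∣ k → 2 ∣ n →
  (∀ S → ¬ Isolating G S) → GBC G k
GBC-if-no-isolating-set {n} G {k} 1≤k 2∣k 2∣n no-isolating = n∣m⇒m%n≡0 n 2 2∣n , ∅-barrier , only-∅
  where
  k-even : k % 2 ≡ 0
  k-even = n∣m⇒m%n≡0 k 2 2∣k
  few-isolated : ∀ T → isolated G T ≤ ∣ T ∣
  few-isolated T with isolated G T ≤? ∣ T ∣
  ... | yes i≤s = i≤s
  ... | no  i≰s = contradiction (≤-trans (s≤s z≤n) (≰⇒> i≰s) , <⇒≤ (≰⇒> i≰s)) (no-isolating T)
  φ∅≡0 : φ G k ⊥ ≡ ℤ.+ 0
  φ∅≡0 = trans (φ-even G k ⊥ k-even)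
               (trans (cong₂ (λ i s → (k * i) ⊖ (k * s)) i≡0 (∣⊥∣≡0 n)) (n⊖n≡0 (k * 0)))
    where
    i≡0 : isolated G ⊥ ≡ 0
    i≡0 = n≤0⇒n≡0 (subst (isolated G ⊥ ≤_) (∣⊥∣≡0 n) (few-isolated ⊥))
  ∅-barrier : Barrier G k ⊥
  ∅-barrier T = subst (φ G k T ≤ℤ_) (sym φ∅≡0) (φ-even-≤0 G k T k-even (few-isolated T))
  only-∅ : ∀ S → Barrier G k S → S ≡ ⊥
  only-∅ S barrier
    with 1 ≤? isolated G S | φ-even-≥0 G k S 1≤k k-even (subst (_≤ℤ φ G k S) φ∅≡0 (barrier ⊥))
  ... | yes 1≤i | s≤i = contradiction (1≤i , s≤i) (no-isolating S)
  ... | no  1≰i | s≤i = ∣p∣≡0⇒p≡⊥ S (n≤0⇒n≡0 (≤-trans s≤i (≤-pred (≰⇒> 1≰i))))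

GBC-unless-subJoin : (G : Graph n) {k δ : ℕ} → 1 ≤ k → 2 ∣ k → 2 ∣ n → MinDegreeAtLeast G δ →
  (∀ {s q i} → δ ≤ s → s ≤ i → ¬ IsSubJoin G s q i) → GBC G k
GBC-unless-subJoin G 1≤k 2∣k 2∣n δ≤deg no-subJoin =
  GBC-if-no-isolating-set G 1≤k 2∣k 2∣n λ S (some-isolated , s≤i) →
    no-subJoin (minDegree≤∣S∣ G S δ≤deg some-isolated) s≤i (removal-isSubJoin G S)

-- Maximising the edge count of a join

double-pairs : ∀ m → 2 * pairs m + m ≡ m * m
double-pairs zero    = refl
double-pairs (suc m) = begin
  2 * (m + pairs m) + suc m      ≡⟨ lemma m (pairs m) ⟩
  (2 * pairs m + m) + (2 * m + 1) ≡⟨ cong (_+ (2 * m + 1)) (double-pairs m) ⟩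
  m * m + (2 * m + 1)            ≡⟨ square-suc m ⟩
  suc m * suc m                  ∎
  where
  open ≡-Reasoning
  lemma : ∀ m p → 2 * (m + p) + suc m ≡ (2 * p + m) + (2 * m + 1)
  lemma = solve-∀
  square-suc : ∀ m → m * m + (2 * m + 1) ≡ suc m * suc m
  square-suc = solve-∀

double-joinEdges : ∀ s q i → 2 * joinEdges s q i + (s + q) ≡ s * s + 2 * s * (q + i) + q * q
double-joinEdges s q i = begin
  2 * joinEdges s q i + (s + q)
    ≡⟨ lemma s q i (pairs s) (pairs q) ⟩
  (2 * pairs s + s) + 2 * s * (q + i) + (2 * pairs q + q)
    ≡⟨ cong₂ (λ x y → x + 2 * s * (q + i) + y) (double-pairs s) (double-pairs q) ⟩
  s * s + 2 * s * (q + i) + q * q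
    ∎
  where
  open ≡-Reasoning
  lemma : ∀ s q i ps pq →
    2 * (ps + s * (q + i) + pq) + (s + q) ≡ (2 * ps + s) + 2 * s * (q + i) + (2 * pq + q)
  lemma = solve-∀

-- Both sides are first doubled, which turns them into polynomials.
joinEdges-identity : ∀ s q i s′ q′ i′ {a b} →
  s * s + 2 * s * (q + i) + q * q + a + (s′ + q′)
    ≡ s′ * s′ + 2 * s′ * (q′ + i′) + q′ * q′ + b + (s + q) →
  2 * joinEdges s q i + a ≡ 2 * joinEdges s′ q′ i′ + b
joinEdges-identity s q i s′ q′ i′ {a} {b} polynomial = +-cancelʳ-≡ (s + q + (s′ + q′)) _ _ (begin
  2 * joinEdges s q i + a + (s + q + (s′ + q′))
    ≡⟨ lemma (2 * joinEdges s q i) a (s + q) (s′ + q′) ⟩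
  2 * joinEdges s q i + (s + q) + a + (s′ + q′)
    ≡⟨ cong (λ x → x + a + (s′ + q′)) (double-joinEdges s q i) ⟩
  s * s + 2 * s * (q + i) + q * q + a + (s′ + q′)
    ≡⟨ polynomial ⟩
  s′ * s′ + 2 * s′ * (q′ + i′) + q′ * q′ + b + (s + q)
    ≡⟨ cong (λ x → x + b + (s + q)) (sym (double-joinEdges s′ q′ i′)) ⟩
  2 * joinEdges s′ q′ i′ + (s′ + q′) + b + (s + q)
    ≡⟨ lemma′ (2 * joinEdges s′ q′ i′) b (s + q) (s′ + q′) ⟩
  2 * joinEdges s′ q′ i′ + b + (s + q + (s′ + q′))
    ∎)
  where
  open ≡-Reasoning
  lemma : ∀ x a u v → x + a + (u + v) ≡ x + u + a + v
  lemma = solve-∀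
  lemma′ : ∀ x b u v → x + v + b + u ≡ x + b + (u + v)
  lemma′ = solve-∀

joinEdges-shift : ∀ s q d → 2 * joinEdges s q (s + d) + d * (2 * q + d) ≡ 2 * joinEdges s (q + d) s + d
joinEdges-shift s q d = joinEdges-identity s q (s + d) s (q + d) s (polynomial s q d)
  where
  polynomial : ∀ s q d →
    s * s + 2 * s * (q + (s + d)) + q * q + d * (2 * q + d) + (s + (q + d))
    ≡ s * s + 2 * s * ((q + d) + s) + (q + d) * (q + d) + d + (s + q)
  polynomial = solve-∀

joinEdges-promote : ∀ s t q →
  2 * joinEdges s (2 * t + q) s + t * (2 * s + 1) ≡ 2 * joinEdges (s + t) q (s + t) + t * (t + 2 * q)
joinEdges-promote s t q = joinEdges-identity s (2 * t + q) s (s + t) q (s + t) (polynomial s t q)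
  where
  polynomial : ∀ s t q →
    s * s + 2 * s * ((2 * t + q) + s) + (2 * t + q) * (2 * t + q) + t * (2 * s + 1) + ((s + t) + q)
    ≡ (s + t) * (s + t) + 2 * (s + t) * (q + (s + t)) + q * q + t * (t + 2 * q) + (s + (2 * t + q))
  polynomial = solve-∀

halve-≤ : ∀ {x y a b} → 2 * x + a ≡ 2 * y + b → b ≤ a → x ≤ y
halve-≤ {x} {y} {a} {b} eq b≤a = *-cancelˡ-≤ 2 (+-cancelʳ-≤ a (2 * x) (2 * y) (begin
  2 * x + a   ≡⟨ eq ⟩
  2 * y + b   ≤⟨ +-monoʳ-≤ (2 * y) b≤a ⟩
  2 * y + a   ∎))
  where open ≤-Reasoning

halve-≡ : ∀ {x y a b} → 2 * x + a ≡ 2 * y + b → x ≡ y → a ≡ b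
halve-≡ {x} eq refl = +-cancelˡ-≡ (2 * x) _ _ eq

*-cancelˡ-≡-or-0 : ∀ t {a b} → t * a ≡ t * b → t ≡ 0 ⊎ a ≡ b
*-cancelˡ-≡-or-0 zero    _  = inj₁ refl
*-cancelˡ-≡-or-0 (suc t) eq = inj₂ (*-cancelˡ-≡ _ _ (suc t) eq)

squeeze : ∀ {a b c} → a ≤ b → b ≤ c → c ≤ a → a ≡ b × b ≡ c
squeeze a≤b b≤c c≤a = ≤-antisym a≤b (≤-trans b≤c c≤a) , ≤-antisym b≤c (≤-trans c≤a a≤b)

joinEdges-shift-≤ : ∀ s q d → joinEdges s q (s + d) ≤ joinEdges s (q + d) s
joinEdges-shift-≤ s q d = halve-≤ (joinEdges-shift s q d) (d≤d*[2q+d] d)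
  where
  d≤d*[2q+d] : ∀ d → d ≤ d * (2 * q + d)
  d≤d*[2q+d] zero    = z≤n
  d≤d*[2q+d] (suc d) = begin
    suc d                  ≡⟨ sym (*-identityʳ (suc d)) ⟩
    suc d * 1              ≤⟨ *-monoʳ-≤ (suc d) (≤-trans (s≤s z≤n) (m≤n+m (suc d) (2 * q))) ⟩
    suc d * (2 * q + suc d) ∎
    where open ≤-Reasoning

joinEdges-shift-tight : ∀ s q d → joinEdges s q (s + d) ≡ joinEdges s (q + d) s → 2 ≤ q + d → d ≡ 0
joinEdges-shift-tight s q d eq 2≤q+d
  with *-cancelˡ-≡-or-0 d (trans (halve-≡ (joinEdges-shift s q d) eq) (sym (*-identityʳ d)))
... | inj₁ d≡0     = d≡0
... | inj₂ 2q+d≡1 =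
  contradiction (≤-trans 2≤q+d (≤-trans (+-monoˡ-≤ d (m≤m+n q (q + 0))) (≤-reflexive 2q+d≡1))) λ { (s≤s ()) }

joinEdges-promote-≤ : ∀ s t q → 2 * s + 1 ≤ t + 2 * q →
  joinEdges (s + t) q (s + t) ≤ joinEdges s (2 * t + q) s
joinEdges-promote-≤ s t q gain = halve-≤ (sym (joinEdges-promote s t q)) (*-monoʳ-≤ t gain)

joinEdges-promote-≥ : ∀ s t q → t + 2 * q ≤ 2 * s + 1 →
  joinEdges s (2 * t + q) s ≤ joinEdges (s + t) q (s + t)
joinEdges-promote-≥ s t q loss = halve-≤ (joinEdges-promote s t q) (*-monoʳ-≤ t loss)

joinEdges-promote-tight : ∀ s t q → joinEdges s (2 * t + q) s ≡ joinEdges (s + t) q (s + t) →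
  t ≡ 0 ⊎ 2 * s + 1 ≡ t + 2 * q
joinEdges-promote-tight s t q eq = *-cancelˡ-≡-or-0 t (halve-≡ (joinEdges-promote s t q) eq)

double-≤ : ∀ t q → 2 * t + q ≤ 2 * (t + 2 * q)
double-≤ t q = subst (2 * t + q ≤_) (lemma t q) (m≤m+n (2 * t + q) (3 * q))
  where
  lemma : ∀ t q → 2 * t + q + 3 * q ≡ 2 * (t + 2 * q)
  lemma = solve-∀

double-injective : ∀ {a b} → a + 0 + a ≡ b + 0 + b → a ≡ b
double-injective {a} {b} eq = *-cancelˡ-≡ a b 2 (trans (lemma a) (trans eq (sym (lemma b))))
  where
  lemma : ∀ a → 2 * a ≡ a + 0 + a
  lemma = solve-∀

double-≤-injective : ∀ {a b} → a + 0 + a ≤ b + 0 + b → a ≤ b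
double-≤-injective {a} {b} le = *-cancelˡ-≤ 2 (subst₂ _≤_ (sym (lemma a)) (sym (lemma b)) le)
  where
  lemma : ∀ a → 2 * a ≡ a + 0 + a
  lemma = solve-∀

regroup-total : ∀ δ t q d → δ + t + q + (δ + t + d) ≡ δ + δ + (2 * t + (q + d))
regroup-total = solve-∀

δ+δ≤6δ+2 : ∀ δ → δ + δ ≤ 6 * δ + 2
δ+δ≤6δ+2 δ = subst (δ + δ ≤_) (lemma δ) (m≤m+n (δ + δ) (4 * δ + 2))
  where
  lemma : ∀ δ → δ + δ + (4 * δ + 2) ≡ 6 * δ + 2
  lemma = solve-∀

extremal-triple : ∀ {δ t q d r} → t ≡ 0 → d ≡ 0 → r ≡ 2 * t + (q + d) →
  (δ + t , q , δ + t + d) ≡ (δ , r , δ)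
extremal-triple {δ} {q = q} refl refl refl =
  cong₂ _,_ (+-identityʳ δ) (cong₂ _,_ (sym (+-identityʳ q)) (trans (+-identityʳ (δ + 0)) (+-identityʳ δ)))

balanced-triple : ∀ {x q d m} → q ≡ 0 → d ≡ 0 → x + q + (x + d) ≡ m + 0 + m →
  (x , q , x + d) ≡ (m , 0 , m)
balanced-triple {x} refl refl eq = cong₂ _,_ x≡m (cong (0 ,_) (trans (+-identityʳ x) x≡m))
  where
  x≡m = double-injective (trans (cong (x + 0 +_) (sym (+-identityʳ x))) eq)

joinEdges-max-large : ∀ {δ s q i r n} → δ ≤ s → s ≤ i → s + q + i ≡ n → δ + r + δ ≡ n →
  6 * δ + 2 < n → joinEdges δ r δ ≤ joinEdges s q i → (s , q , i) ≡ (δ , r , δ)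
joinEdges-max-large {δ} {q = q} {r = r} {n} δ≤s s≤i total total′ large e≤
  with m≤n⇒∃[o]m+o≡n δ≤s | m≤n⇒∃[o]m+o≡n s≤i
... | t , refl | d , refl = extremal-triple t≡0 (joinEdges-shift-tight (δ + t) q d (proj₁ squeezed) 2≤q+d) r≡
  where
  n≡ : n ≡ δ + δ + (2 * t + (q + d))
  n≡ = trans (sym total) (regroup-total δ t q d)
  r≡ : r ≡ 2 * t + (q + d)
  r≡ = +-cancelˡ-≡ (δ + δ) _ _ (trans (sym (a+b+a≡a+a+b δ r)) (trans total′ n≡))
  surplus : 4 * δ + 3 ≤ 2 * t + (q + d)
  surplus = +-cancelˡ-≤ (δ + δ) _ _ (subst₂ _≤_ (lemma δ) n≡ large)
    where
    lemma : ∀ δ → suc (6 * δ + 2) ≡ δ + δ + (4 * δ + 3)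
    lemma = solve-∀
  gain : 2 * δ + 1 < t + 2 * (q + d)
  gain = *-cancelˡ-< 2 _ _ (≤-trans (subst (_≤ 2 * t + (q + d)) (lemma δ) surplus) (double-≤ t (q + d)))
    where
    lemma : ∀ δ → 4 * δ + 3 ≡ suc (2 * (2 * δ + 1))
    lemma = solve-∀
  squeezed = squeeze (joinEdges-shift-≤ (δ + t) q d) (joinEdges-promote-≤ δ t (q + d) (<⇒≤ gain))
                    (subst (λ x → joinEdges δ x δ ≤ _) r≡ e≤)
  t≡0 : t ≡ 0
  t≡0 with joinEdges-promote-tight δ t (q + d) (sym (proj₂ squeezed))
  ... | inj₁ t≡0  = t≡0
  ... | inj₂ gain≡ = contradiction gain≡ (<⇒≢ gain)
  2≤q+d : 2 ≤ q + d
  2≤q+d = ≤-trans (s≤s (s≤s z≤n))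
            (≤-trans (m≤n+m 3 (4 * δ)) (subst (λ t → 4 * δ + 3 ≤ 2 * t + (q + d)) t≡0 surplus))

joinEdges-max-critical : ∀ {δ s q i r m n} → δ ≤ s → s ≤ i → s + q + i ≡ n → δ + r + δ ≡ n →
  m + 0 + m ≡ n → n ≡ 6 * δ + 2 → joinEdges δ r δ ≤ joinEdges s q i →
  (s , q , i) ≡ (δ , r , δ) ⊎ (s , q , i) ≡ (m , 0 , m)
joinEdges-max-critical {δ} {q = q} {r = r} {n = n} δ≤s s≤i total total′ total″ critical e≤
  with m≤n⇒∃[o]m+o≡n δ≤s | m≤n⇒∃[o]m+o≡n s≤i
... | t , refl | d , refl = conclude (joinEdges-promote-tight δ t (q + d) (sym (proj₂ squeezed)))
  where
  n≡ : n ≡ δ + δ + (2 * t + (q + d))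
  n≡ = trans (sym total) (regroup-total δ t q d)
  r≡ : r ≡ 2 * t + (q + d)
  r≡ = +-cancelˡ-≡ (δ + δ) _ _ (trans (sym (a+b+a≡a+a+b δ r)) (trans total′ n≡))
  surplus : 2 * t + (q + d) ≡ 2 * (2 * δ + 1)
  surplus = +-cancelˡ-≡ (δ + δ) _ _ (trans (sym n≡) (trans critical (lemma δ)))
    where
    lemma : ∀ δ → 6 * δ + 2 ≡ δ + δ + 2 * (2 * δ + 1)
    lemma = solve-∀
  gain : 2 * δ + 1 ≤ t + 2 * (q + d)
  gain = *-cancelˡ-≤ 2 (subst (_≤ 2 * (t + 2 * (q + d))) surplus (double-≤ t (q + d)))
  squeezed = squeeze (joinEdges-shift-≤ (δ + t) q d) (joinEdges-promote-≤ δ t (q + d) gain)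
                    (subst (λ x → joinEdges δ x δ ≤ _) r≡ e≤)
  conclude : t ≡ 0 ⊎ 2 * δ + 1 ≡ t + 2 * (q + d) →
    (δ + t , q , δ + t + d) ≡ (δ , r , δ) ⊎ (δ + t , q , δ + t + d) ≡ (_ , 0 , _)
  conclude (inj₁ t≡0) =
    inj₁ (extremal-triple t≡0 (joinEdges-shift-tight (δ + t) q d (proj₁ squeezed) 2≤q+d) r≡)
    where
    2≤q+d : 2 ≤ q + d
    2≤q+d = subst (2 ≤_) (sym (subst (λ t → 2 * t + (q + d) ≡ 2 * (2 * δ + 1)) t≡0 surplus))
                  (*-monoʳ-≤ 2 (m≤n+m 1 (2 * δ)))
  conclude (inj₂ gain≡) =
    inj₂ (balanced-triple (m+n≡0⇒m≡0 q q+d≡0) (m+n≡0⇒n≡0 q q+d≡0) (trans total (sym total″)))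
    where
    3[q+d]≡0 : 3 * (q + d) ≡ 0
    3[q+d]≡0 = +-cancelˡ-≡ (2 * t + (q + d)) _ _ (begin
      2 * t + (q + d) + 3 * (q + d)    ≡⟨ lemma t (q + d) ⟩
      2 * (t + 2 * (q + d))            ≡⟨ cong (2 *_) (sym gain≡) ⟩
      2 * (2 * δ + 1)                  ≡⟨ sym surplus ⟩
      2 * t + (q + d)                  ≡⟨ sym (+-identityʳ _) ⟩
      2 * t + (q + d) + 0              ∎)
      where
      open ≡-Reasoning
      lemma : ∀ t x → 2 * t + x + 3 * x ≡ 2 * (t + 2 * x)
      lemma = solve-∀
    q+d≡0 : q + d ≡ 0
    q+d≡0 = *-cancelˡ-≡ (q + d) 0 3 3[q+d]≡0

joinEdges-max-small : ∀ {δ s q i m n} → δ ≤ s → s ≤ i → s + q + i ≡ n → m + 0 + m ≡ n →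
  n < 6 * δ + 2 → joinEdges m 0 m ≤ joinEdges s q i → (s , q , i) ≡ (m , 0 , m)
joinEdges-max-small {δ} {s} {q} {m = m} {n} δ≤s s≤i total total′ small e≤ with m≤n⇒∃[o]m+o≡n s≤i
... | d , refl with m≤n⇒∃[o]m+o≡n s≤m
  where
  s≤m : s ≤ m
  s≤m = double-≤-injective (begin
    s + 0 + s        ≤⟨ +-mono-≤ (+-monoʳ-≤ s z≤n) (m≤m+n s d) ⟩
    s + q + (s + d)  ≡⟨ trans total (sym total′) ⟩
    m + 0 + m        ∎)
    where open ≤-Reasoning
... | u , refl = balanced-triple (m+n≡0⇒m≡0 q q+d≡0) (m+n≡0⇒n≡0 q q+d≡0) (trans total (sym total′))
  where
  split : s + s + (q + d) ≡ s + s + 2 * u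
  split = trans (lemma₁ s q d) (trans total (trans (sym total′) (lemma₂ s u)))
    where
    lemma₁ : ∀ s q d → s + s + (q + d) ≡ s + q + (s + d)
    lemma₁ = solve-∀
    lemma₂ : ∀ s u → s + u + 0 + (s + u) ≡ s + s + 2 * u
    lemma₂ = solve-∀
  q+d≡2u : q + d ≡ 2 * u
  q+d≡2u = +-cancelˡ-≡ (s + s) _ _ split
  u<2s+1 : u < 2 * s + 1
  u<2s+1 = *-cancelˡ-< 2 _ _ (+-cancelˡ-< (s + s) _ _ (begin-strict
    s + s + 2 * u               ≡⟨ sym split ⟩
    s + s + (q + d)             ≡⟨ trans (lemma₁ s q d) total ⟩
    n                           <⟨ small ⟩
    6 * δ + 2                   ≤⟨ +-monoˡ-≤ 2 (*-monoʳ-≤ 6 δ≤s) ⟩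
    6 * s + 2                   ≡⟨ lemma₂ s ⟩
    s + s + 2 * (2 * s + 1)     ∎))
    where
    open ≤-Reasoning
    lemma₁ : ∀ s q d → s + s + (q + d) ≡ s + q + (s + d)
    lemma₁ = solve-∀
    lemma₂ : ∀ s → 6 * s + 2 ≡ s + s + 2 * (2 * s + 1)
    lemma₂ = solve-∀
  squeezed = squeeze (subst (λ x → joinEdges s q (s + d) ≤ joinEdges s x s)
                            (trans q+d≡2u (sym (+-identityʳ (2 * u)))) (joinEdges-shift-≤ s q d))
                    (joinEdges-promote-≥ s u 0 (subst (_≤ 2 * s + 1) (sym (+-identityʳ u)) (<⇒≤ u<2s+1)))
                    e≤
  u≡0 : u ≡ 0
  u≡0 with joinEdges-promote-tight s u 0 (proj₂ squeezed)
  ... | inj₁ u≡0 = u≡0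
  ... | inj₂ eq  = contradiction (trans (sym (+-identityʳ u)) (sym eq)) (<⇒≢ u<2s+1)
  q+d≡0 : q + d ≡ 0
  q+d≡0 = trans q+d≡2u (cong (2 *_) u≡0)

joinEdges-tie : ∀ {δ r m n} → δ + r + δ ≡ n → m + 0 + m ≡ n → n ≡ 6 * δ + 2 →
  joinEdges m 0 m ≡ joinEdges δ r δ
joinEdges-tie {δ} {r} {m} total total′ critical = begin
  joinEdges m 0 m               ≡⟨ cong (λ x → joinEdges x 0 x) m≡ ⟩
  joinEdges (δ + t) 0 (δ + t)   ≡⟨ sym promoted ⟩
  joinEdges δ (2 * t + 0) δ     ≡⟨ cong (λ x → joinEdges δ x δ) (sym r≡) ⟩
  joinEdges δ r δ               ∎
  where
  open ≡-Reasoning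
  t = 2 * δ + 1
  m≡ : m ≡ δ + t
  m≡ = double-injective (trans total′ (trans critical (lemma δ)))
    where
    lemma : ∀ δ → 6 * δ + 2 ≡ δ + (2 * δ + 1) + 0 + (δ + (2 * δ + 1))
    lemma = solve-∀
  r≡ : r ≡ 2 * t + 0
  r≡ = +-cancelˡ-≡ (δ + δ) _ _ (trans (sym (a+b+a≡a+a+b δ r)) (trans total (trans critical (lemma δ))))
    where
    lemma : ∀ δ → 6 * δ + 2 ≡ δ + δ + (2 * (2 * δ + 1) + 0)
    lemma = solve-∀
  promoted : joinEdges δ (2 * t + 0) δ ≡ joinEdges (δ + t) 0 (δ + t)
  promoted = *-cancelˡ-≡ _ _ 2 (+-cancelʳ-≡ (t * t) _ _
    (trans (joinEdges-promote δ t 0) (cong (λ x → 2 * joinEdges (δ + t) 0 (δ + t) + t * x) (+-identityʳ t))))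

edges-tie : (K H : Graph n) {δ r m : ℕ} → IsJoin K δ r δ → IsJoin H m 0 m → n ≡ 6 * δ + 2 →
  edges H ≡ edges K
edges-tie K H {δ} {r} {m} K-join H-join critical = begin
  edges H           ≡⟨ isJoin-edges H H-join ⟩
  joinEdges m 0 m   ≡⟨ joinEdges-tie {δ} {r} {m} (IsJoin.total K-join) (IsJoin.total H-join) critical ⟩
  joinEdges δ r δ   ≡⟨ sym (isJoin-edges K K-join) ⟩
  edges K           ∎
  where open ≡-Reasoning

join-bound : (G K : Graph n) {a b d : ℕ} → IsSubJoin G s q i → IsJoin K a b d → edges K ≤ edges G →
  joinEdges a b d ≤ joinEdges s q i
join-bound {s = s} {q} {i} G K {a} {b} {d} sub K-join eK≤eG = begin
  joinEdges a b d   ≡⟨ sym (isJoin-edges K K-join) ⟩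
  edges K           ≤⟨ eK≤eG ⟩
  edges G           ≤⟨ isSubJoin-edges G sub ⟩
  joinEdges s q i   ∎
  where open ≤-Reasoning

≅-if-forced : (G K : Graph n) {a b d : ℕ} → IsSubJoin G s q i → IsJoin K a b d → edges K ≤ edges G →
  (s , q , i) ≡ (a , b , d) → G ≅ K
≅-if-forced G K sub K-join eK≤eG refl =
  isJoin-≅ G K (isSubJoin-tight G sub (≤-trans (≤-reflexive (sym (isJoin-edges K K-join))) eK≤eG)) K-join

theorem4p2 : (δ k n : ℕ) (G : Graph n) →
    1 ≤ δ → 1 ≤ k → 2 ∣ k → 2 ∣ n → 4 ≤ n →
    Connected G → MinDegreeAtLeast G δ →
    ((6 * δ + 2 < n) → edges (KdJoin n δ) ≤ edges G →
       ¬ (G ≅ KdJoin n δ) → GBC G k)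
    × ((n ≡ 6 * δ + 2) → edges (KdJoin n δ) ≤ edges G →
       ¬ (G ≅ KdJoin n δ) → ¬ (G ≅ KhalfJoin n) → GBC G k)
    × ((n < 6 * δ + 2) → edges (KhalfJoin n) ≤ edges G →
       ¬ (G ≅ KhalfJoin n) → GBC G k)
theorem4p2 δ k n G _ 1≤k 2∣k 2∣n _ _ δ≤deg = large , critical , small
  where
  m : ℕ
  m = _∣_.quotient 2∣n
  H : IsJoin (KhalfJoin n) m 0 m
  H = KhalfJoin-isJoin n m (_∣_.equality 2∣n)
  K : δ + δ ≤ n → IsJoin (KdJoin n δ) δ (n ∸ (δ + δ)) δ
  K = KdJoin-isJoin n δ
  gbc : (∀ {s q i} → δ ≤ s → s ≤ i → ¬ IsSubJoin G s q i) → GBC G k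
  gbc = GBC-unless-subJoin G 1≤k 2∣k 2∣n δ≤deg
  large : 6 * δ + 2 < n → edges (KdJoin n δ) ≤ edges G → ¬ (G ≅ KdJoin n δ) → GBC G k
  large n>6δ+2 eK≤eG G≇K = gbc λ δ≤s s≤i sub → G≇K (≅-if-forced G _ sub K′ eK≤eG
    (joinEdges-max-large δ≤s s≤i (IsSubJoin.total sub) (IsJoin.total K′) n>6δ+2 (join-bound G _ sub K′ eK≤eG)))
    where
    K′ = K (≤-trans (δ+δ≤6δ+2 δ) (<⇒≤ n>6δ+2))
  critical : n ≡ 6 * δ + 2 → edges (KdJoin n δ) ≤ edges G →
    ¬ (G ≅ KdJoin n δ) → ¬ (G ≅ KhalfJoin n) → GBC G k
  critical n≡6δ+2 eK≤eG G≇K G≇H = gbc λ δ≤s s≤i sub →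
    [ G≇K ∘ ≅-if-forced G _ sub K′ eK≤eG , G≇H ∘ ≅-if-forced G _ sub H eH≤eG ]
      (joinEdges-max-critical δ≤s s≤i (IsSubJoin.total sub) (IsJoin.total K′) (IsJoin.total H) n≡6δ+2
        (join-bound G _ sub K′ eK≤eG))
    where
    K′ = K (subst (δ + δ ≤_) (sym n≡6δ+2) (δ+δ≤6δ+2 δ))
    eH≤eG = ≤-trans (≤-reflexive (edges-tie _ _ K′ H n≡6δ+2)) eK≤eG
  small : n < 6 * δ + 2 → edges (KhalfJoin n) ≤ edges G → ¬ (G ≅ KhalfJoin n) → GBC G k
  small n<6δ+2 eH≤eG G≇H = gbc λ δ≤s s≤i sub → G≇H (≅-if-forced G _ sub H eH≤eG
    (joinEdges-max-small δ≤s s≤i (IsSubJoin.total sub) (IsJoin.total H) n<6δ+2 (join-bound G _ sub H eH≤eG)))
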